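{- For positive integers $k\geq l$, $\eta(k+1,l)\geq \eta(k,l)+2$.
   Context: All graphs are finite and simple. The odd-girth of a graph is the length of its shortest odd cycle. $C_n$ denotes the cycle of length $n$. A homomorphism from $G$ to $H$ is a map $V(G)\to V(H)$ sending adjacent vertices to adjacent vertices. For positive integers $k,l$, $\eta(k,l)$ denotes the smallest number of vertices of a graph of odd-girth $2k+1$ that admits no homomorphism to $C_{2l+1}$. -}

module Defs where

open import Data.Nat using (ℕ; zero; suc; _+_; _*_; _≤_; _<_; _%_)
open import Data.Fin using (Fin; toℕ)
open import Data.Product using (Σ; _×_)
open import Data.Sum using (_⊎_)
open import Relation.Nullary using (¬_)
open import Relation.Binary.PropositionalEquality using (_≡_)
open import Function.Definitions using (Injective)

record Graph : Set₁ where
  field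
    n      : ℕ
    Adj    : Fin n → Fin n → Set
    sym    : ∀ {x y} → Adj x y → Adj y x
    irrefl : ∀ {x} → ¬ Adj x x
open Graph public

CAdj : (p : ℕ) → Fin (suc p) → Fin (suc p) → Set
CAdj p i j = (suc (toℕ i) % suc p ≡ toℕ j) ⊎ (suc (toℕ j) % suc p ≡ toℕ i)

HasOddCycle : Graph → ℕ → Set
HasOddCycle G r =
  Σ (Fin (suc (2 * r)) → Fin (n G)) λ v →
    Injective _≡_ _≡_ v × (∀ i j → CAdj (2 * r) i j → Adj G (v i) (v j))

OddGirth : Graph → ℕ → Set
OddGirth G k = HasOddCycle G k × (∀ r → 1 ≤ r → r < k → ¬ HasOddCycle G r)

HomToOddCycle : Graph → ℕ → Set
HomToOddCycle G l =
  Σ (Fin (n G) → Fin (suc (2 * l))) λ f →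
    ∀ {x y} → Adj G x y → CAdj (2 * l) (f x) (f y)

IsEta : ℕ → ℕ → ℕ → Set₁
IsEta k l a =
  Σ Graph (λ G → (n G ≡ a) × OddGirth G k × ¬ HomToOddCycle G l)
  × (∀ G → OddGirth G k → ¬ HomToOddCycle G l → a ≤ n G)

-- Take a shortest odd cycle x v₁ y v₃ … of a graph G of odd girth 2k+3 with no homomorphism to
-- C_{2l+1}. If v₁ has a neighbour z other than x and y, identify x, y and z; otherwise delete v₁
-- (mapping it to v₃) and identify x with y. Either way G maps onto a graph G' with two vertices fewer,
-- so G' has no homomorphism to C_{2l+1} either. The rest of the cycle becomes a (2k+1)-cycle of G',
-- and a shorter odd cycle of G' passes the single identified vertex at most once, so it lifts to an
-- odd closed walk of G of length at most 2k+1, which contains an odd cycle shorter than 2k+3.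

module Submission where

open import Defs renaming (sym to Adj-sym)
open import Data.Nat using (ℕ; zero; suc; _+_; _*_; _∸_; _≤_; _<_; _%_; z≤n; s≤s; _≤?_; _≟_; parity)
open import Data.Nat.Properties
open import Data.Nat.DivMod
  using (_mod_; m%n<n; m<n⇒m%n≡m; m≤n⇒m%n≡m; n%n≡0; [m+n]%n≡m%n; %-distribˡ-+; m%n%n≡m%n)
open import Data.Nat.Induction using (<-rec)
open import Data.Parity.Base using (0ℙ; 1ℙ) renaming (_+_ to _+ℙ_)
import Data.Parity.Properties as ℙ
open import Data.Fin using (Fin; toℕ; punchOut) renaming (zero to fzero; suc to fsuc)
open import Data.Fin.Properties
  using (toℕ-injective; toℕ<n; toℕ-fromℕ<; punchOut-cong; punchOut-injective; any?; all?; pigeonhole)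
  renaming (_≟_ to _≟ᶠ_)
open import Data.List using (List; []; _∷_)
open import Data.List.Relation.Unary.All using (All; []; _∷_)
open import Data.List.Relation.Unary.All.Properties using (¬Any⇒All¬)
open import Data.List.Relation.Unary.Any using (here; there)
open import Data.List.Membership.Propositional using (_∈_)
open import Data.List.Membership.DecPropositional using (_∈?_)
open import Data.List.Relation.Unary.Unique.Propositional using (Unique)
open import Data.List.Relation.Unary.AllPairs using ([]; _∷_)
open import Data.Bool using (Bool; true; false; T)
open import Data.Vec using (Vec; []; _∷_; lookup; tabulate)
open import Data.Vec.Properties using (lookup∘tabulate)
open import Data.Product using (Σ; ∃; ∃-syntax; _×_; _,_; proj₁; proj₂)
open import Data.Sum using (_⊎_; inj₁; inj₂)
open import Data.Empty using (⊥; ⊥-elim)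
open import Data.Unit using (⊤; tt)
open import Relation.Nullary using (¬_; Dec; yes; no; ¬?)
open import Relation.Nullary.Decidable
  using (¬¬-excluded-middle; _×-dec_; _⊎-dec_; _→-dec_; map′; isYes; T?; toWitness; fromWitness; decidable-stable)
open import Relation.Nullary.Negation using (¬¬-map)
open import Relation.Unary using (Decidable)
open import Relation.Binary.PropositionalEquality
open import Function.Base using (_∘′_)
open import Function.Definitions using (Injective)

-- Parity, walks and odd cycles

parity-2* : ∀ r → parity (2 * r) ≡ 0ℙ
parity-2* r = ℙ.*-homo-* 2 r

parity-1+2* : ∀ r → parity (suc (2 * r)) ≡ 1ℙ
parity-1+2* r = trans (ℙ.+-homo-+ 1 (2 * r)) (cong (1ℙ +ℙ_) (parity-2* r))

odd⇒1+2* : ∀ {L} → parity L ≡ 1ℙ → ∃[ r ] L ≡ suc (2 * r)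
odd⇒1+2* {1} _ = 0 , refl
odd⇒1+2* {suc (suc L)} odd with odd⇒1+2* {L} odd
... | r , refl = suc r , cong suc (sym (*-suc 2 r))

parity-+-odd : ∀ m n → parity (m + n) ≡ 1ℙ → parity m ≡ 1ℙ ⊎ parity n ≡ 1ℙ
parity-+-odd m n odd with parity m in pm
... | 1ℙ = inj₁ refl
... | 0ℙ = inj₂ (trans (sym (cong (_+ℙ parity n) pm)) (trans (sym (ℙ.+-homo-+ m n)) odd))

data Walk (G : Graph) : Fin (n G) → Fin (n G) → ℕ → Set where
  []  : ∀ {a} → Walk G a a 0
  _∷_ : ∀ {a b c m} → Adj G a b → Walk G b c m → Walk G a c (suc m)

module _ {G : Graph} where

  private
    V = Fin (n G)

  infixr 5 _++_

  _++_ : ∀ {a b c m m'} → Walk G a b m → Walk G b c m' → Walk G a c (m + m')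
  [] ++ w = w
  (e ∷ v) ++ w = e ∷ (v ++ w)

  _∷ʳ_ : ∀ {a b c m} → Walk G a b m → Adj G b c → Walk G a c (suc m)
  [] ∷ʳ e = e ∷ []
  (e' ∷ w) ∷ʳ e = e' ∷ (w ∷ʳ e)

  castLength : ∀ {a b m m'} → m ≡ m' → Walk G a b m → Walk G a b m'
  castLength refl w = w

  vertices : ∀ {a b m} → Walk G a b m → List V
  vertices [] = []
  vertices (_∷_ {a} _ w) = a ∷ vertices w

  vertexAt : ∀ {a b m} → Walk G a b m → ℕ → V
  vertexAt {a} [] _ = a
  vertexAt {a} (_ ∷ _) zero = a
  vertexAt (_ ∷ w) (suc s) = vertexAt w s

  vertexAt-first : ∀ {a b m} (w : Walk G a b m) → vertexAt w 0 ≡ a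
  vertexAt-first [] = refl
  vertexAt-first (_ ∷ _) = refl

  vertexAt-last : ∀ {a b m} (w : Walk G a b m) → vertexAt w m ≡ b
  vertexAt-last [] = refl
  vertexAt-last (_ ∷ w) = vertexAt-last w

  vertexAt-step : ∀ {a b m} (w : Walk G a b m) s → s < m → Adj G (vertexAt w s) (vertexAt w (suc s))
  vertexAt-step (e ∷ w) zero _ = subst (Adj G _) (sym (vertexAt-first w)) e
  vertexAt-step (_ ∷ w) (suc s) (s≤s s<m) = vertexAt-step w s s<m

  vertexAt∈vertices : ∀ {a b m} {P : V → Set} (w : Walk G a b m) → All P (vertices w) →
                      ∀ s → s < m → P (vertexAt w s)
  vertexAt∈vertices (_ ∷ _) (pa ∷ _) zero _ = pa
  vertexAt∈vertices (_ ∷ w) (_ ∷ ps) (suc s) (s≤s s<m) = vertexAt∈vertices w ps s s<m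

  vertexAt-injective : ∀ {a b m} (w : Walk G a b m) → Unique (vertices w) →
                       ∀ {s t} → s < m → t < m → vertexAt w s ≡ vertexAt w t → s ≡ t
  vertexAt-injective (_ ∷ w) _ {zero} {zero} _ _ _ = refl
  vertexAt-injective (_ ∷ w) (a∉ ∷ _) {zero} {suc t} _ (s≤s t<m) eq =
    ⊥-elim (vertexAt∈vertices w a∉ t t<m eq)
  vertexAt-injective (_ ∷ w) (a∉ ∷ _) {suc s} {zero} (s≤s s<m) _ eq =
    ⊥-elim (vertexAt∈vertices w a∉ s s<m (sym eq))
  vertexAt-injective (_ ∷ w) (_ ∷ u) {suc s} {suc t} (s≤s s<m) (s≤s t<m) eq =
    cong suc (vertexAt-injective w u s<m t<m eq)

suc-mod : ∀ s p → suc (s % suc p) % suc p ≡ suc s % suc p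
suc-mod s p = begin
  (1 + s % suc p) % suc p                 ≡⟨ %-distribˡ-+ 1 (s % suc p) (suc p) ⟩
  (1 % suc p + s % suc p % suc p) % suc p ≡⟨ cong (λ t → (1 % suc p + t) % suc p) (m%n%n≡m%n s _) ⟩
  (1 % suc p + s % suc p) % suc p         ≡⟨ sym (%-distribˡ-+ 1 s (suc p)) ⟩
  suc s % suc p                           ∎
  where open ≡-Reasoning

shift-mod-≢ : ∀ {p i s} → i ≤ p → 0 < s → s ≤ p → (i + s) % suc p ≢ i
shift-mod-≢ {p} {i} {suc s} i≤p _ s≤p eq with i + suc s ≤? p
... | yes i+s≤p = m+1+n≢m i (trans (sym (m≤n⇒m%n≡m i+s≤p)) eq)
... | no i+s≰p = 1+n≰n (subst (_≤ p) (+-cancelˡ-≡ i (suc s) (suc p) i+s≡i+1+p) s≤p)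
  where
  open ≡-Reasoning
  t = i + suc s ∸ suc p
  wrap : t + suc p ≡ i + suc s
  wrap = m∸n+n≡m (≰⇒> i+s≰p)
  t<1+p : t < suc p
  t<1+p = +-cancelʳ-< (suc p) t (suc p)
    (subst (_< suc p + suc p) (sym wrap) (s≤s (+-mono-≤ i≤p (≤-trans s≤p (n≤1+n p)))))
  t≡i : t ≡ i
  t≡i = begin
    t                     ≡⟨ sym (m<n⇒m%n≡m t<1+p) ⟩
    t % suc p             ≡⟨ sym ([m+n]%n≡m%n t (suc p)) ⟩
    (t + suc p) % suc p   ≡⟨ cong (_% suc p) wrap ⟩
    (i + suc s) % suc p   ≡⟨ eq ⟩
    i                     ∎
  i+s≡i+1+p : i + suc s ≡ i + suc p
  i+s≡i+1+p = trans (sym wrap) (cong (_+ suc p) t≡i)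

module _ {G : Graph} where

  closedSequence⇒cycleHom : ∀ p (f : ℕ → Fin (n G)) →
    (∀ s → s < p → Adj G (f s) (f (suc s))) → Adj G (f p) (f 0) →
    ∀ i j → CAdj p i j → Adj G (f (toℕ i)) (f (toℕ j))
  closedSequence⇒cycleHom p f step close i j (inj₁ i+1≡j) with m≤n⇒m<n∨m≡n (toℕ<n i)
  ... | inj₁ (s≤s i<p) =
    subst (Adj G _ ∘′ f) (trans (sym (m<n⇒m%n≡m (s≤s i<p))) i+1≡j) (step (toℕ i) i<p)
  ... | inj₂ i+1≡1+p =
    subst₂ (λ s t → Adj G (f s) (f t)) (sym (suc-injective i+1≡1+p))
      (trans (sym (n%n≡0 (suc p))) (trans (cong (_% suc p) (sym i+1≡1+p)) i+1≡j)) close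
  closedSequence⇒cycleHom p f step close i j (inj₂ j+1≡i) =
    Adj-sym G (closedSequence⇒cycleHom p f step close j i (inj₁ j+1≡i))

  module CycleSequence {p} (c : Fin (suc p) → Fin (n G)) where

    at : ℕ → Fin (n G)
    at s = c (s mod suc p)

    toℕ-mod : ∀ s → toℕ (s mod suc p) ≡ s % suc p
    toℕ-mod s = toℕ-fromℕ< (m%n<n s (suc p))

    at-step : (∀ i j → CAdj p i j → Adj G (c i) (c j)) → ∀ s → Adj G (at s) (at (suc s))
    at-step hom s = hom (s mod suc p) (suc s mod suc p) (inj₁ (begin
      suc (toℕ (s mod suc p)) % suc p ≡⟨ cong (λ t → suc t % suc p) (toℕ-mod s) ⟩
      suc (s % suc p) % suc p         ≡⟨ suc-mod s p ⟩
      suc s % suc p                   ≡⟨ sym (toℕ-mod (suc s)) ⟩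
      toℕ (suc s mod suc p)           ∎))
      where open ≡-Reasoning

    at-toℕ : ∀ i → at (toℕ i) ≡ c i
    at-toℕ i = cong c (toℕ-injective (trans (toℕ-mod (toℕ i)) (m<n⇒m%n≡m (toℕ<n i))))

    at-periodic : ∀ s → at (suc p + s) ≡ at s
    at-periodic s = cong c (toℕ-injective (begin
      toℕ ((suc p + s) mod suc p) ≡⟨ toℕ-mod (suc p + s) ⟩
      (suc p + s) % suc p         ≡⟨ cong (_% suc p) (+-comm (suc p) s) ⟩
      (s + suc p) % suc p         ≡⟨ [m+n]%n≡m%n s (suc p) ⟩
      s % suc p                   ≡⟨ sym (toℕ-mod s) ⟩
      toℕ (s mod suc p)           ∎))
      where open ≡-Reasoning

    module _ (c-injective : Injective _≡_ _≡_ c) where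

      at≡⇒%≡ : ∀ {s t} → at s ≡ at t → s % suc p ≡ t % suc p
      at≡⇒%≡ {s} {t} eq = trans (sym (toℕ-mod s)) (trans (cong toℕ (c-injective eq)) (toℕ-mod t))

      at-injective : ∀ {s t} → s < suc p → t < suc p → at s ≡ at t → s ≡ t
      at-injective {s} {t} s<1+p t<1+p eq =
        trans (sym (m<n⇒m%n≡m s<1+p)) (trans (at≡⇒%≡ {s} {t} eq) (m<n⇒m%n≡m t<1+p))

      at-shift-≢ : ∀ {i s} → i ≤ p → 0 < s → s ≤ p → at (i + s) ≢ at i
      at-shift-≢ {i} {s} i≤p 0<s s≤p eq =
        shift-mod-≢ i≤p 0<s s≤p (trans (at≡⇒%≡ {i + s} {i} eq) (m<n⇒m%n≡m (s≤s i≤p)))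

      avoidingStart : ∀ w → ∃[ i₀ ] ∀ {s} → 0 < s → s ≤ p → at (i₀ + s) ≢ w
      avoidingStart w with any? (λ i → c i ≟ᶠ w)
      ... | yes (i , cᵢ≡w) = toℕ i , λ 0<s s≤p eq →
              at-shift-≢ (≤-pred (toℕ<n i)) 0<s s≤p (trans eq (sym (trans (at-toℕ i) cᵢ≡w)))
      ... | no avoids = 0 , λ {s} _ _ eq → avoids (s mod suc p , eq)

    pathAlong : (∀ s → Adj G (at s) (at (suc s))) → ∀ s d → Walk G (at s) (at (s + d)) d
    pathAlong step s zero = subst (λ t → Walk G (at s) (at t) 0) (sym (+-identityʳ s)) []
    pathAlong step s (suc d) =
      step s ∷ subst (λ t → Walk G (at (suc s)) (at t) d) (sym (+-suc s d))
                     (pathAlong step (suc s) d)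

module _ {G : Graph} where

  private
    V = Fin (n G)

  splitAtVertex : ∀ {a b c m} (w : Walk G c b m) → a ∈ vertices w →
                  ∃[ ℓ₁ ] ∃[ ℓ₂ ] Walk G c a ℓ₁ × Walk G a b (suc ℓ₂) × ℓ₁ + suc ℓ₂ ≡ m
  splitAtVertex (e ∷ w) (here refl) = 0 , _ , [] , e ∷ w , refl
  splitAtVertex (e ∷ w) (there a∈w) with splitAtVertex w a∈w
  ... | ℓ₁ , ℓ₂ , before , after , len = suc ℓ₁ , ℓ₂ , e ∷ before , after , cong suc len

  record Repetition (a b : V) (m : ℕ) : Set where
    field
      {u}        : V
      {ℓ₁ ℓ₂ ℓ₃} : ℕ
      before     : Walk G a u ℓ₁
      loop       : Walk G u u (suc ℓ₂)
      after      : Walk G u b ℓ₃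
      length     : suc ℓ₂ + (ℓ₁ + ℓ₃) ≡ m
      nontrivial : 0 < ℓ₁ + ℓ₃

  decompose : ∀ {a b m} (w : Walk G a b m) → Unique (vertices w) ⊎ Repetition a b m
  decompose [] = inj₁ []
  decompose (_∷_ {a} e w) with decompose w
  ... | inj₂ record { ℓ₁ = ℓ₁ ; ℓ₂ = ℓ₂ ; ℓ₃ = ℓ₃ ; before = before ; loop = loop ; after = after
                     ; length = length } =
    inj₂ (record { before = e ∷ before ; loop = loop ; after = after
                 ; length = trans (+-suc (suc ℓ₂) (ℓ₁ + ℓ₃)) (cong suc length)
                 ; nontrivial = s≤s z≤n })
  ... | inj₁ unique with _∈?_ _≟ᶠ_ a (vertices w)
  ...   | no a∉w = inj₁ (¬Any⇒All¬ (vertices w) a∉w ∷ unique)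
  ...   | yes a∈w with splitAtVertex w a∈w
  ...     | ℓ₁ , ℓ₂ , before , after , len = inj₂ (record
              { before = [] ; loop = e ∷ before ; after = after
              ; length = cong suc len ; nontrivial = s≤s z≤n })

  uniqueClosedWalk⇒cycle : ∀ {a r} (w : Walk G a a (suc (2 * r))) → Unique (vertices w) →
                           HasOddCycle G r
  uniqueClosedWalk⇒cycle {r = r} w unique = vertexAt w ∘′ toℕ , injective , hom
    where
    injective : Injective _≡_ _≡_ (vertexAt w ∘′ toℕ)
    injective {i} {j} eq = toℕ-injective (vertexAt-injective w unique (toℕ<n i) (toℕ<n j) eq)
    close : Adj G (vertexAt w (2 * r)) (vertexAt w 0)
    close = subst (Adj G _) (trans (vertexAt-last w) (sym (vertexAt-first w)))
                  (vertexAt-step w (2 * r) ≤-refl)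
    hom : ∀ i j → CAdj (2 * r) i j → Adj G (vertexAt w (toℕ i)) (vertexAt w (toℕ j))
    hom = closedSequence⇒cycleHom {G = G} (2 * r) (vertexAt w)
            (λ s s<2r → vertexAt-step w s (m<n⇒m<1+n s<2r)) close

  no-loop : ∀ {a} → ¬ Walk G a a 1
  no-loop (e ∷ []) = irrefl G e

  OddCycleWithin : ℕ → Set
  OddCycleWithin L = ∃[ r ] 1 ≤ r × suc (2 * r) ≤ L × HasOddCycle G r

  oddClosedWalk⇒oddCycle : ∀ {a L} → Walk G a a L → parity L ≡ 1ℙ → OddCycleWithin L
  oddClosedWalk⇒oddCycle {L = L} = <-rec P extract L
    where
    P : ℕ → Set
    P L = ∀ {a} → Walk G a a L → parity L ≡ 1ℙ → OddCycleWithin L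

    weaken : ∀ {L L'} → L ≤ L' → OddCycleWithin L → OddCycleWithin L'
    weaken L≤L' (r , 1≤r , bound , cycle) = r , 1≤r , ≤-trans bound L≤L' , cycle

    extract : ∀ L → (∀ {L'} → L' < L → P L') → P L
    extract L rec w odd with decompose w
    ... | inj₁ unique with odd⇒1+2* {L} odd
    ...   | zero , refl = ⊥-elim (no-loop w)
    ...   | suc r , refl = suc r , s≤s z≤n , ≤-refl , uniqueClosedWalk⇒cycle {r = suc r} w unique
    extract L rec w odd | inj₂ record { ℓ₁ = ℓ₁ ; ℓ₂ = ℓ₂ ; ℓ₃ = ℓ₃ ; before = before ; loop = loop
                                       ; after = after ; length = refl ; nontrivial = nontrivial }
      with parity-+-odd (suc ℓ₂) (ℓ₁ + ℓ₃) odd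
    ... | inj₁ loop-odd = weaken (<⇒≤ loop<L) (rec loop<L loop loop-odd)
      where
      loop<L : suc ℓ₂ < suc ℓ₂ + (ℓ₁ + ℓ₃)
      loop<L = m<m+n (suc ℓ₂) nontrivial
    ... | inj₂ rest-odd = weaken (<⇒≤ rest<L) (rec rest<L (before ++ after) rest-odd)
      where
      rest<L : ℓ₁ + ℓ₃ < suc ℓ₂ + (ℓ₁ + ℓ₃)
      rest<L = m<n+m (ℓ₁ + ℓ₃) {suc ℓ₂} (s≤s z≤n)

oddGirth⇒noShorterOddWalk : ∀ {G K a L} → OddGirth G K → Walk G a a L → parity L ≡ 1ℙ →
                            L < suc (2 * K) → ⊥
oddGirth⇒noShorterOddWalk {K = K} (_ , shortest) w odd L<1+2K with oddClosedWalk⇒oddCycle w odd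
... | r , 1≤r , 1+2r≤L , cycle =
  shortest r 1≤r (*-cancelˡ-< 2 r K (≤-pred (≤-trans (s≤s 1+2r≤L) L<1+2K))) cycle

-- Identifying vertices

OneOf : ∀ {A : Set} → A → A → A → Set
OneOf i j u = u ≡ i ⊎ u ≡ j

module _ {N : ℕ} {i j : Fin (suc N)} (i≢j : i ≢ j) where

  identify : Fin (suc N) → Fin N
  identify u with u ≟ᶠ j
  ... | yes _ = punchOut (i≢j ∘′ sym)
  ... | no u≢j = punchOut (u≢j ∘′ sym)

  identify-identifies : identify i ≡ identify j
  identify-identifies with i ≟ᶠ j | j ≟ᶠ j
  ... | yes i≡j | _ = ⊥-elim (i≢j i≡j)
  ... | no _ | no j≢j = ⊥-elim (j≢j refl)
  ... | no _ | yes _ = punchOut-cong j refl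

  identify-fibre : ∀ {u u'} → identify u ≡ identify u' → u ≡ u' ⊎ (OneOf i j u × OneOf i j u')
  identify-fibre {u} {u'} eq with u ≟ᶠ j | u' ≟ᶠ j
  ... | yes u≡j | yes u'≡j = inj₁ (trans u≡j (sym u'≡j))
  ... | yes u≡j | no _ = inj₂ (inj₂ u≡j , inj₁ (sym (punchOut-injective {i = j} _ _ eq)))
  ... | no _ | yes u'≡j = inj₂ (inj₁ (punchOut-injective {i = j} _ _ eq) , inj₂ u'≡j)
  ... | no _ | no _ = inj₁ (punchOut-injective {i = j} _ _ eq)

module Quotient (G : Graph) {m} (q : Fin (n G) → Fin m) (S : Fin (n G) → Set)
                (separated : ∀ {u u'} → S u → S u' → Adj G u u' → q u ≢ q u') where

  record EdgeAbove (a b : Fin m) : Set where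
    field
      {src tgt} : Fin (n G)
      src∈S     : S src
      tgt∈S     : S tgt
      edge      : Adj G src tgt
      q-src     : q src ≡ a
      q-tgt     : q tgt ≡ b

  open EdgeAbove

  quotient : Graph
  quotient = record
    { n = m
    ; Adj = EdgeAbove
    ; sym = λ e → record { src∈S = tgt∈S e ; tgt∈S = src∈S e ; edge = Adj-sym G (edge e)
                         ; q-src = q-tgt e ; q-tgt = q-src e }
    ; irrefl = λ e → separated (src∈S e) (tgt∈S e) (edge e) (trans (q-src e) (sym (q-tgt e)))
    }

  module _ (w : Fin m)
           (fibre : ∀ {u u'} → S u → S u' → q u ≡ q u' → u ≡ u' ⊎ (q u ≡ w × Walk G u u' 2)) where

    -- Starting the lift at a position i₀ after which the cycle avoids w for a full turn, every junction
    -- but the closing one is an equality, and the closing one costs at most a walk of length 2.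
    liftOddCycleFrom : ∀ {r} (c : Fin (suc (2 * r)) → Fin m) →
                       (∀ i j → CAdj (2 * r) i j → EdgeAbove (c i) (c j)) →
                       ∀ i₀ → (∀ {s} → 0 < s → s ≤ 2 * r → CycleSequence.at {G = quotient} c (i₀ + s) ≢ w) →
                       ∃[ a ] ∃[ ℓ ] Walk G a a (suc (2 * ℓ)) × ℓ ≤ suc r
    liftOddCycleFrom {r} c c-hom i₀ avoids = close (fibre (tgt∈S (E p)) (src∈S (E 0)) returns)
      where
      p = 2 * r
      open CycleSequence {G = quotient} {p} c

      E : ∀ s → EdgeAbove (at (i₀ + s)) (at (i₀ + suc s))
      E s = subst (λ t → EdgeAbove (at (i₀ + s)) (at t)) (sym (+-suc i₀ s)) (at-step c-hom (i₀ + s))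

      path : ∀ j → j ≤ p → Walk G (src (E 0)) (tgt (E j)) (suc j)
      path zero _ = edge (E 0) ∷ []
      path (suc j) j<p
        with fibre (tgt∈S (E j)) (src∈S (E (suc j))) (trans (q-tgt (E j)) (sym (q-src (E (suc j)))))
      ... | inj₁ junction =
        path j (<⇒≤ j<p) ∷ʳ subst (λ u → Adj G u (tgt (E (suc j)))) (sym junction) (edge (E (suc j)))
      ... | inj₂ (q≡w , _) = ⊥-elim (avoids (s≤s z≤n) j<p (trans (sym (q-tgt (E j))) q≡w))

      returns : q (tgt (E p)) ≡ q (src (E 0))
      returns = begin
        q (tgt (E p))        ≡⟨ q-tgt (E p) ⟩
        at (i₀ + suc p)      ≡⟨ cong at (+-comm i₀ (suc p)) ⟩
        at (suc p + i₀)      ≡⟨ at-periodic i₀ ⟩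
        at i₀                ≡⟨ cong at (sym (+-identityʳ i₀)) ⟩
        at (i₀ + 0)          ≡⟨ sym (q-src (E 0)) ⟩
        q (src (E 0))        ∎
        where open ≡-Reasoning

      close : tgt (E p) ≡ src (E 0) ⊎ (q (tgt (E p)) ≡ w × Walk G (tgt (E p)) (src (E 0)) 2) →
              ∃[ a ] ∃[ ℓ ] Walk G a a (suc (2 * ℓ)) × ℓ ≤ suc r
      close (inj₁ end≡start) =
        src (E 0) , r , subst (λ u → Walk G (src (E 0)) u (suc p)) end≡start (path p ≤-refl) , n≤1+n r
      close (inj₂ (_ , back)) =
        src (E 0) , suc r ,
        castLength (trans (+-comm (suc p) 2) (cong suc (sym (*-suc 2 r)))) (path p ≤-refl ++ back) ,
        ≤-refl

    liftOddCycle : ∀ {r} → HasOddCycle quotient r →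
                   ∃[ a ] ∃[ ℓ ] Walk G a a (suc (2 * ℓ)) × ℓ ≤ suc r
    liftOddCycle (c , c-injective , c-hom)
      with CycleSequence.avoidingStart {G = quotient} c c-injective w
    ... | i₀ , avoids = liftOddCycleFrom c c-hom i₀ avoids

-- Homomorphisms and the contraction of a shortest odd cycle

record Hom (G H : Graph) : Set where
  constructor mkHom
  field
    map       : Fin (n G) → Fin (n H)
    preserves : ∀ {x y} → Adj G x y → Adj H (map x) (map y)

homToOddCycle-∘ : ∀ {G H l} → Hom G H → HomToOddCycle H l → HomToOddCycle G l
homToOddCycle-∘ (mkHom φ φ-hom) (f , f-hom) = f ∘′ φ , f-hom ∘′ φ-hom

hasOddCycle-transfer : ∀ {G H r} → (φ : Hom G H) → Injective _≡_ _≡_ (Hom.map φ) →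
                       HasOddCycle G r → HasOddCycle H r
hasOddCycle-transfer (mkHom φ φ-hom) φ-injective (c , c-injective , c-hom) =
  φ ∘′ c , c-injective ∘′ φ-injective , λ i j → φ-hom ∘′ c-hom i j

hasOddCycle⇒length≤n : ∀ {G r} → HasOddCycle G r → suc (2 * r) ≤ n G
hasOddCycle⇒length≤n {G} {r} (c , c-injective , _) with suc (2 * r) ≤? n G
... | yes length≤n = length≤n
... | no length≰n with pigeonhole (≰⇒> length≰n) c
...   | i , j , i<j , cᵢ≡cⱼ = ⊥-elim (<-irrefl (cong toℕ (c-injective cᵢ≡cⱼ)) i<j)

Contraction : Graph → ℕ → Set₁
Contraction G k = Σ Graph λ G' → 2 + n G' ≡ n G × OddGirth G' k × Hom G G'

module ContractionAt (m : ℕ) (A : Fin (2 + m) → Fin (2 + m) → Set)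
                     (A-sym : ∀ {u u'} → A u u' → A u' u) (A-irrefl : ∀ {u} → ¬ A u u)
                     {k} (1≤k : 1 ≤ k) where

  G : Graph
  G = record { n = 2 + m ; Adj = A ; sym = A-sym ; irrefl = A-irrefl }

  module _ (og : OddGirth G (suc k)) where

    p : ℕ
    p = 2 * suc k

    open CycleSequence {G = G} {p} (proj₁ (proj₁ og))

    4≤p : 4 ≤ p
    4≤p = *-monoʳ-≤ 2 (s≤s 1≤k)

    step : ∀ s → A (at s) (at (suc s))
    step = at-step (proj₂ (proj₂ (proj₁ og)))

    position-injective : ∀ {s t} → s ≤ p → t ≤ p → at s ≡ at t → s ≡ t
    position-injective s≤p t≤p = at-injective (proj₁ (proj₂ (proj₁ og))) (s≤s s≤p) (s≤s t≤p)

    distinct : ∀ {s t} → s ≤ p → t ≤ p → s ≢ t → at s ≢ at t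
    distinct s≤p t≤p s≢t = s≢t ∘′ position-injective s≤p t≤p

    ≤4⇒≤p : ∀ {s} → s ≤ 4 → s ≤ p
    ≤4⇒≤p s≤4 = ≤-trans s≤4 4≤p

    noShortOddWalk : ∀ {a L} → Walk G a a L → parity L ≡ 1ℙ → L ≤ p → ⊥
    noShortOddWalk w odd L≤p = oddGirth⇒noShorterOddWalk og w odd (s≤s L≤p)

    x v₁ y v₃ : Fin (2 + m)
    x = at 0
    v₁ = at 1
    y = at 2
    v₃ = at 3

    v₁-triangleFree : ∀ {u u'} → A v₁ u → A v₁ u' → ¬ A u u'
    v₁-triangleFree e e' e'' =
      noShortOddWalk (e ∷ e'' ∷ A-sym e' ∷ []) refl (≤4⇒≤p (s≤s (s≤s (s≤s z≤n))))

    -- A chord splits the cycle into two closed walks through v₁ of odd total length p + 3, each of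
    -- length at most p; one of them is odd.
    v₁-chordFree : ∀ {s} → 3 ≤ s → s ≤ p → ¬ A v₁ (at s)
    v₁-chordFree {suc t} (s≤s 2≤t) 1+t≤p chord = oneIsOdd (parity-+-odd (suc t) (suc d) odd)
      where
      d = suc p ∸ t
      t+d≡1+p : t + d ≡ suc p
      t+d≡1+p = m+[n∸m]≡n (≤-trans (n≤1+n t) (≤-trans 1+t≤p (n≤1+n p)))
      returns : at (suc t + d) ≡ v₁
      returns = begin
        at (suc (t + d))    ≡⟨ cong (at ∘′ suc) t+d≡1+p ⟩
        at (suc (suc p))    ≡⟨ cong (at ∘′ suc) (sym (+-comm p 1)) ⟩
        at (suc p + 1)      ≡⟨ at-periodic 1 ⟩
        v₁                  ∎
        where open ≡-Reasoning
      forward : Walk G v₁ v₁ (suc t)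
      forward = pathAlong step 1 t ∷ʳ A-sym chord
      backward : Walk G v₁ v₁ (suc d)
      backward = chord ∷ subst (λ u → Walk G (at (suc t)) u d) returns (pathAlong step (suc t) d)
      odd : parity (suc t + suc d) ≡ 1ℙ
      odd = trans (cong (parity ∘′ suc) (trans (+-suc t d) (cong suc t+d≡1+p))) (parity-1+2* (suc k))
      oneIsOdd : parity (suc t) ≡ 1ℙ ⊎ parity (suc d) ≡ 1ℙ → ⊥
      oneIsOdd (inj₁ odd-forward) = noShortOddWalk forward odd-forward 1+t≤p
      oneIsOdd (inj₂ odd-backward) =
        noShortOddWalk backward odd-backward (s≤s (∸-monoʳ-≤ (suc p) 2≤t))

    2+s≤p : ∀ {s} → s ≤ 2 * k → 2 + s ≤ p
    2+s≤p {s} s≤2k = subst (2 + s ≤_) (sym (*-suc 2 k)) (s≤s (s≤s s≤2k))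

    module ContractVia (q : Fin (2 + m) → Fin m) (S : Fin (2 + m) → Set)
        (separated : ∀ {u u'} → S u → S u' → A u u' → q u ≢ q u')
        (fibre : ∀ {u u'} → S u → S u' → q u ≡ q u' → u ≡ u' ⊎ (q u ≡ q x × Walk G u u' 2))
        (x≈y : q x ≡ q y)
        (q-injective-on-cycle :
           ∀ {s t} → 2 ≤ s → s ≤ p → 2 ≤ t → t ≤ p → q (at s) ≡ q (at t) → s ≡ t)
        (x∈S : S x) (cycle⊆S : ∀ {s} → 2 ≤ s → s ≤ p → S (at s))
        (hom : ∀ {u u'} → A u u' → Quotient.EdgeAbove G q S separated (q u) (q u')) where

      open Quotient G q S separated

      f : ℕ → Fin m
      f s = q (at (2 + s))

      edgeAlong : ∀ {s} → s < 2 * k → EdgeAbove (f s) (f (suc s))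
      edgeAlong {s} s<2k = record
        { src∈S = cycle⊆S (m≤m+n 2 s) (2+s≤p (<⇒≤ s<2k))
        ; tgt∈S = cycle⊆S (m≤m+n 2 (suc s)) (2+s≤p s<2k)
        ; edge = step (2 + s) ; q-src = refl ; q-tgt = refl }

      wraps : at (3 + 2 * k) ≡ x
      wraps = trans (cong (at ∘′ suc) (trans (sym (*-suc 2 k)) (sym (+-identityʳ p)))) (at-periodic 0)

      edgeClosing : EdgeAbove (f (2 * k)) (f 0)
      edgeClosing = record
        { src∈S = cycle⊆S (m≤m+n 2 (2 * k)) (2+s≤p ≤-refl) ; tgt∈S = subst S (sym wraps) x∈S
        ; edge = step (2 + 2 * k) ; q-src = refl ; q-tgt = trans (cong q wraps) x≈y }

      imageCycle : HasOddCycle quotient k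
      imageCycle = f ∘′ toℕ , injective
                 , closedSequence⇒cycleHom {G = quotient} (2 * k) f (λ _ → edgeAlong) edgeClosing
        where
        injective : Injective _≡_ _≡_ (f ∘′ toℕ)
        injective {i} {j} eq = toℕ-injective (+-cancelˡ-≡ 2 _ _
          (q-injective-on-cycle (m≤m+n 2 (toℕ i)) (2+s≤p (≤-pred (toℕ<n i)))
                                (m≤m+n 2 (toℕ j)) (2+s≤p (≤-pred (toℕ<n j))) eq))

      noShorterCycle : ∀ r → 1 ≤ r → r < k → ¬ HasOddCycle quotient r
      noShorterCycle r _ r<k cycle = noShortLift (liftOddCycle (q x) fibre cycle)
        where
        noShortLift : ¬ (∃[ a ] ∃[ ℓ ] Walk G a a (suc (2 * ℓ)) × ℓ ≤ suc r)
        noShortLift (_ , ℓ , w , ℓ≤1+r) = noShortOddWalk w (parity-1+2* ℓ)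
          (≤-trans (s≤s (*-monoʳ-≤ 2 (≤-trans ℓ≤1+r r<k))) (≤-trans (n≤1+n _) (2+s≤p ≤-refl)))

      contraction : Contraction G k
      contraction = quotient , refl , (imageCycle , noShorterCycle) , mkHom q hom

    x≢y : x ≢ y
    x≢y = distinct z≤n (≤4⇒≤p (s≤s (s≤s z≤n))) (λ ())

    q₁ : Fin (2 + m) → Fin (1 + m)
    q₁ = identify x≢y

    v₁~xy : ∀ {u} → OneOf x y u → A v₁ u
    v₁~xy (inj₁ refl) = A-sym (step 0)
    v₁~xy (inj₂ refl) = step 1

    xy-position : ∀ {s} → 2 ≤ s → s ≤ p → OneOf x y (at s) → s ≡ 2
    xy-position 2≤s s≤p (inj₁ at≡x) = ⊥-elim (distinct s≤p z≤n (m<n⇒n≢0 2≤s) at≡x)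
    xy-position 2≤s s≤p (inj₂ at≡y) = position-injective s≤p (≤4⇒≤p (s≤s (s≤s z≤n))) at≡y

    module ThirdNeighbour (z : Fin (2 + m)) (v₁~z : A v₁ z) (z≢x : z ≢ x) (z≢y : z ≢ y) where

      Merged : Fin (2 + m) → Set
      Merged u = OneOf x y u ⊎ u ≡ z

      q₁x≢q₁z : q₁ x ≢ q₁ z
      q₁x≢q₁z eq with identify-fibre x≢y eq
      ... | inj₁ x≡z = z≢x (sym x≡z)
      ... | inj₂ (_ , inj₁ z≡x) = z≢x z≡x
      ... | inj₂ (_ , inj₂ z≡y) = z≢y z≡y

      q : Fin (2 + m) → Fin m
      q = identify q₁x≢q₁z ∘′ q₁

      merged-from-q₁ : ∀ {u} → OneOf (q₁ x) (q₁ z) (q₁ u) → Merged u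
      merged-from-q₁ (inj₁ eq) with identify-fibre x≢y eq
      ... | inj₁ u≡x = inj₁ (inj₁ u≡x)
      ... | inj₂ (u∈xy , _) = inj₁ u∈xy
      merged-from-q₁ (inj₂ eq) with identify-fibre x≢y eq
      ... | inj₁ u≡z = inj₂ u≡z
      ... | inj₂ (u∈xy , _) = inj₁ u∈xy

      q-fibre : ∀ {u u'} → q u ≡ q u' → u ≡ u' ⊎ (Merged u × Merged u')
      q-fibre eq with identify-fibre q₁x≢q₁z eq
      ... | inj₂ (a , b) = inj₂ (merged-from-q₁ a , merged-from-q₁ b)
      ... | inj₁ eq₁ with identify-fibre x≢y eq₁
      ...   | inj₁ u≡u' = inj₁ u≡u'
      ...   | inj₂ (a , b) = inj₂ (inj₁ a , inj₁ b)

      v₁~merged : ∀ {u} → Merged u → A v₁ u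
      v₁~merged (inj₁ u∈xy) = v₁~xy u∈xy
      v₁~merged (inj₂ refl) = v₁~z

      merged-q : ∀ {u} → Merged u → q u ≡ q x
      merged-q (inj₁ (inj₁ refl)) = refl
      merged-q (inj₁ (inj₂ refl)) = cong (identify q₁x≢q₁z) (sym (identify-identifies x≢y))
      merged-q (inj₂ refl) = sym (identify-identifies q₁x≢q₁z)

      merged-position : ∀ {s} → 2 ≤ s → s ≤ p → Merged (at s) → s ≡ 2
      merged-position 2≤s s≤p (inj₁ at∈xy) = xy-position 2≤s s≤p at∈xy
      merged-position {s} 2≤s s≤p (inj₂ at≡z) with s ≟ 2
      ... | yes s≡2 = s≡2
      ... | no s≢2 =
        ⊥-elim (v₁-chordFree (≤∧≢⇒< 2≤s (s≢2 ∘′ sym)) s≤p (subst (A v₁) (sym at≡z) v₁~z))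

      separated : ∀ {u u'} → ⊤ → ⊤ → A u u' → q u ≢ q u'
      separated {u} {u'} _ _ e eq with q-fibre {u} {u'} eq
      ... | inj₁ refl = A-irrefl e
      ... | inj₂ (a , b) = v₁-triangleFree (v₁~merged a) (v₁~merged b) e

      fibre : ∀ {u u'} → ⊤ → ⊤ → q u ≡ q u' → u ≡ u' ⊎ (q u ≡ q x × Walk G u u' 2)
      fibre {u} {u'} _ _ eq with q-fibre {u} {u'} eq
      ... | inj₁ u≡u' = inj₁ u≡u'
      ... | inj₂ (a , b) = inj₂ (merged-q a , A-sym (v₁~merged a) ∷ v₁~merged b ∷ [])

      q-injective-on-cycle : ∀ {s t} → 2 ≤ s → s ≤ p → 2 ≤ t → t ≤ p → q (at s) ≡ q (at t) → s ≡ t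
      q-injective-on-cycle {s} {t} 2≤s s≤p 2≤t t≤p eq with q-fibre {at s} {at t} eq
      ... | inj₁ at≡at = position-injective s≤p t≤p at≡at
      ... | inj₂ (a , b) = trans (merged-position 2≤s s≤p a) (sym (merged-position 2≤t t≤p b))

      contraction : Contraction G k
      contraction =
        ContractVia.contraction q (λ _ → ⊤) separated fibre (sym (merged-q (inj₁ (inj₂ refl))))
          q-injective-on-cycle tt (λ _ _ → tt)
          (λ e → record { src∈S = tt ; tgt∈S = tt ; edge = e ; q-src = refl ; q-tgt = refl })

    module NoThirdNeighbour (onlyNeighbours : ∀ {u} → A v₁ u → OneOf x y u) where

      v₁∉xy : ¬ OneOf x y v₁
      v₁∉xy (inj₁ v₁≡x) = distinct (≤4⇒≤p (s≤s z≤n)) z≤n (λ ()) v₁≡x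
      v₁∉xy (inj₂ v₁≡y) = distinct (≤4⇒≤p (s≤s z≤n)) (≤4⇒≤p (s≤s (s≤s z≤n))) (λ ()) v₁≡y

      v₃∉xy : ¬ OneOf x y v₃
      v₃∉xy (inj₁ v₃≡x) = distinct (≤4⇒≤p (s≤s (s≤s (s≤s z≤n)))) z≤n (λ ()) v₃≡x
      v₃∉xy (inj₂ v₃≡y) = distinct (≤4⇒≤p (s≤s (s≤s (s≤s z≤n)))) (≤4⇒≤p (s≤s (s≤s z≤n))) (λ ()) v₃≡y

      q₁-injective-at : ∀ {u w} → ¬ OneOf x y w → q₁ u ≡ q₁ w → u ≡ w
      q₁-injective-at w∉xy eq with identify-fibre x≢y eq
      ... | inj₁ u≡w = u≡w
      ... | inj₂ (_ , w∈xy) = ⊥-elim (w∉xy w∈xy)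

      q₁v₁≢q₁v₃ : q₁ v₁ ≢ q₁ v₃
      q₁v₁≢q₁v₃ =
        distinct (≤4⇒≤p (s≤s z≤n)) (≤4⇒≤p (s≤s (s≤s (s≤s z≤n)))) (λ ()) ∘′ q₁-injective-at v₃∉xy

      q : Fin (2 + m) → Fin m
      q = identify q₁v₁≢q₁v₃ ∘′ q₁

      q-fibre : ∀ {u u'} → q u ≡ q u' →
                u ≡ u' ⊎ (OneOf x y u × OneOf x y u') ⊎ (OneOf v₁ v₃ u × OneOf v₁ v₃ u')
      q-fibre eq with identify-fibre q₁v₁≢q₁v₃ eq
      ... | inj₂ (a , b) = inj₂ (inj₂ (pull a , pull b))
        where
        pull : ∀ {u} → OneOf (q₁ v₁) (q₁ v₃) (q₁ u) → OneOf v₁ v₃ u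
        pull (inj₁ eq₁) = inj₁ (q₁-injective-at v₁∉xy eq₁)
        pull (inj₂ eq₃) = inj₂ (q₁-injective-at v₃∉xy eq₃)
      ... | inj₁ eq₁ with identify-fibre x≢y eq₁
      ...   | inj₁ u≡u' = inj₁ u≡u'
      ...   | inj₂ ab = inj₂ (inj₁ ab)

      -- Deleting v₁ is encoded by identifying it with v₃ and keeping only the edges that avoid v₁.
      S : Fin (2 + m) → Set
      S u = u ≢ v₁

      is-v₃ : ∀ {u} → S u → OneOf v₁ v₃ u → u ≡ v₃
      is-v₃ u≢v₁ (inj₁ u≡v₁) = ⊥-elim (u≢v₁ u≡v₁)
      is-v₃ _ (inj₂ u≡v₃) = u≡v₃

      xy-q : ∀ {u} → OneOf x y u → q u ≡ q x
      xy-q (inj₁ refl) = refl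
      xy-q (inj₂ refl) = cong (identify q₁v₁≢q₁v₃) (sym (identify-identifies x≢y))

      separated : ∀ {u u'} → S u → S u' → A u u' → q u ≢ q u'
      separated {u} {u'} u∈S u'∈S e eq with q-fibre {u} {u'} eq
      ... | inj₁ refl = A-irrefl e
      ... | inj₂ (inj₁ (a , b)) = v₁-triangleFree (v₁~xy a) (v₁~xy b) e
      ... | inj₂ (inj₂ (a , b)) = A-irrefl (subst (A u) (trans (is-v₃ u'∈S b) (sym (is-v₃ u∈S a))) e)

      fibre : ∀ {u u'} → S u → S u' → q u ≡ q u' → u ≡ u' ⊎ (q u ≡ q x × Walk G u u' 2)
      fibre {u} {u'} u∈S u'∈S eq with q-fibre {u} {u'} eq
      ... | inj₁ u≡u' = inj₁ u≡u'
      ... | inj₂ (inj₁ (a , b)) = inj₂ (xy-q a , A-sym (v₁~xy a) ∷ v₁~xy b ∷ [])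
      ... | inj₂ (inj₂ (a , b)) = inj₁ (trans (is-v₃ u∈S a) (sym (is-v₃ u'∈S b)))

      v₁v₃-position : ∀ {s} → 2 ≤ s → s ≤ p → OneOf v₁ v₃ (at s) → s ≡ 3
      v₁v₃-position 2≤s s≤p (inj₁ at≡v₁) = ⊥-elim (distinct s≤p (≤4⇒≤p (s≤s z≤n)) (>⇒≢ 2≤s) at≡v₁)
      v₁v₃-position 2≤s s≤p (inj₂ at≡v₃) = position-injective s≤p (≤4⇒≤p (s≤s (s≤s (s≤s z≤n)))) at≡v₃

      q-injective-on-cycle : ∀ {s t} → 2 ≤ s → s ≤ p → 2 ≤ t → t ≤ p → q (at s) ≡ q (at t) → s ≡ t
      q-injective-on-cycle {s} {t} 2≤s s≤p 2≤t t≤p eq with q-fibre {at s} {at t} eq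
      ... | inj₁ at≡at = position-injective s≤p t≤p at≡at
      ... | inj₂ (inj₁ (a , b)) = trans (xy-position 2≤s s≤p a) (sym (xy-position 2≤t t≤p b))
      ... | inj₂ (inj₂ (a , b)) = trans (v₁v₃-position 2≤s s≤p a) (sym (v₁v₃-position 2≤t t≤p b))

      cycle⊆S : ∀ {s} → 2 ≤ s → s ≤ p → S (at s)
      cycle⊆S 2≤s s≤p = distinct s≤p (≤4⇒≤p (s≤s z≤n)) (>⇒≢ 2≤s)

      open Quotient G q S separated using (EdgeAbove)

      fromV₁ : ∀ {u'} → A v₁ u' → EdgeAbove (q v₁) (q u')
      fromV₁ e = record
        { src∈S = cycle⊆S (s≤s (s≤s z≤n)) (≤4⇒≤p (s≤s (s≤s (s≤s z≤n))))
        ; tgt∈S = cycle⊆S ≤-refl (≤4⇒≤p (s≤s (s≤s z≤n)))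
        ; edge = A-sym (step 2)
        ; q-src = sym (identify-identifies q₁v₁≢q₁v₃)
        ; q-tgt = trans (xy-q (inj₂ refl)) (sym (xy-q (onlyNeighbours e))) }

      hom : ∀ {u u'} → A u u' → EdgeAbove (q u) (q u')
      hom {u} {u'} e with u ≟ᶠ v₁ | u' ≟ᶠ v₁
      ... | yes refl | _ = fromV₁ e
      ... | no _ | yes refl = Graph.sym (Quotient.quotient G q S separated) (fromV₁ (A-sym e))
      ... | no u∈S | no u'∈S =
        record { src∈S = u∈S ; tgt∈S = u'∈S ; edge = e ; q-src = refl ; q-tgt = refl }

      contraction : Contraction G k
      contraction = ContractVia.contraction q S separated fibre (sym (xy-q (inj₂ refl)))
        q-injective-on-cycle (distinct z≤n (≤4⇒≤p (s≤s z≤n)) (λ ())) cycle⊆S hom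

    contraction : ¬ ¬ Contraction G k
    contraction ¬contraction = ¬¬-excluded-middle {A = ∃[ z ] A v₁ z × z ≢ x × z ≢ y} λ
      { (yes (z , v₁~z , z≢x , z≢y)) → ¬contraction (ThirdNeighbour.contraction z v₁~z z≢x z≢y)
      ; (no noThird) → ¬contraction (NoThirdNeighbour.contraction (onlyNeighbours noThird)) }
      where
      onlyNeighbours : ¬ (∃[ z ] A v₁ z × z ≢ x × z ≢ y) → ∀ {u} → A v₁ u → OneOf x y u
      onlyNeighbours noThird {u} v₁~u with u ≟ᶠ x | u ≟ᶠ y
      ... | yes u≡x | _ = inj₁ u≡x
      ... | no _ | yes u≡y = inj₂ u≡y
      ... | no u≢x | no u≢y = ⊥-elim (noThird (u , v₁~u , u≢x , u≢y))

oddGirth⇒contraction : ∀ {k} (G : Graph) → 1 ≤ k → OddGirth G (suc k) → ¬ ¬ Contraction G k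
oddGirth⇒contraction {k} G@record { n = suc (suc m) } 1≤k =
  ContractionAt.contraction m (Adj G) (Adj-sym G) (irrefl G) 1≤k
oddGirth⇒contraction {k} G@record { n = 0 } _ (cycle , _) with hasOddCycle⇒length≤n {G} {suc k} cycle
... | ()
oddGirth⇒contraction {k} G@record { n = 1 } _ (cycle , _) with hasOddCycle⇒length≤n {G} {suc k} cycle
... | s≤s ()

-- Searching for the least order

Searchable : Set → Set₁
Searchable A = ∀ {P : A → Set} → Decidable P → Dec (∃ P)

searchable-Bool : Searchable Bool
searchable-Bool P? with P? true | P? false
... | yes p | _ = yes (true , p)
... | no _ | yes p = yes (false , p)
... | no ¬p | no ¬p' = no λ { (true , p) → ¬p p ; (false , p) → ¬p' p }

searchable-Vec : ∀ {A} → Searchable A → ∀ m → Searchable (Vec A m)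
searchable-Vec _ zero P? = map′ ([] ,_) (λ { ([] , p) → p }) (P? [])
searchable-Vec search (suc m) P? =
  map′ (λ (a , as , p) → a ∷ as , p) (λ { (a ∷ as , p) → a , as , p })
       (search λ a → searchable-Vec search m λ as → P? (a ∷ as))

searchable-Fin→Fin : ∀ a b {P : (Fin a → Fin b) → Set} →
                     (∀ {f g} → (∀ i → f i ≡ g i) → P f → P g) → Decidable P → Dec (∃ P)
searchable-Fin→Fin a b resp P? =
  map′ (λ (v , p) → lookup v , p)
       (λ (f , p) → tabulate f , resp (λ i → sym (lookup∘tabulate f i)) p)
       (searchable-Vec any? a (λ v → P? (lookup v)))

cAdj? : ∀ p (i j : Fin (suc p)) → Dec (CAdj p i j)
cAdj? p i j = (suc (toℕ i) % suc p ≟ toℕ j) ⊎-dec (suc (toℕ j) % suc p ≟ toℕ i)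

module _ (G : Graph) (adj? : ∀ x y → Dec (Adj G x y)) where

  hasOddCycle? : ∀ r → Dec (HasOddCycle G r)
  hasOddCycle? r = searchable-Fin→Fin _ _ respects λ c → injective? c ×-dec hom? c
    where
    OddCycle : (Fin (suc (2 * r)) → Fin (n G)) → Set
    OddCycle c = Injective _≡_ _≡_ c × (∀ i j → CAdj (2 * r) i j → Adj G (c i) (c j))
    respects : ∀ {c c'} → (∀ i → c i ≡ c' i) → OddCycle c → OddCycle c'
    respects c≗c' (c-injective , c-hom) =
      (λ {i} {j} eq → c-injective (trans (c≗c' i) (trans eq (sym (c≗c' j))))) ,
      λ i j e → subst₂ (Adj G) (c≗c' i) (c≗c' j) (c-hom i j e)
    injective? : ∀ c → Dec (Injective _≡_ _≡_ c)
    injective? c = map′ (λ inj {i} {j} → inj i j) (λ inj i j → inj)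
                        (all? λ i → all? λ j → (c i ≟ᶠ c j) →-dec (i ≟ᶠ j))
    hom? : ∀ c → Dec (∀ i j → CAdj (2 * r) i j → Adj G (c i) (c j))
    hom? c = all? λ i → all? λ j → cAdj? (2 * r) i j →-dec adj? (c i) (c j)

  oddGirth? : ∀ k → Dec (OddGirth G k)
  oddGirth? k = hasOddCycle? k ×-dec
    map′ (λ none r 1≤r r<k → none {r} r<k 1≤r) (λ none {r} r<k 1≤r → none r 1≤r r<k)
         (allUpTo? (λ r → 1 ≤? r →-dec ¬? (hasOddCycle? r)) k)

  homToOddCycle? : ∀ l → Dec (HomToOddCycle G l)
  homToOddCycle? l =
    map′ (λ (f , f-hom) → f , f-hom _ _) (λ (f , f-hom) → f , λ _ _ → f-hom)
         (searchable-Fin→Fin _ _ respects λ f →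
            all? λ x → all? λ y → adj? x y →-dec cAdj? (2 * l) (f x) (f y))
    where
    IsHom : (Fin (n G) → Fin (suc (2 * l))) → Set
    IsHom f = ∀ x y → Adj G x y → CAdj (2 * l) (f x) (f y)
    respects : ∀ {f f'} → (∀ x → f x ≡ f' x) → IsHom f → IsHom f'
    respects f≗f' f-hom x y e = subst₂ (CAdj (2 * l)) (f≗f' x) (f≗f' y) (f-hom x y e)

-- Adjacency in a Graph need not be decidable, so the least order is searched for among Boolean
-- adjacency matrices; up to double negation every graph has one (good⇒¬¬realisable).
BoolGraph : ℕ → Set
BoolGraph m = Vec (Vec Bool m) m

module _ {m} (B : BoolGraph m) where

  BoolAdj : Fin m → Fin m → Set
  BoolAdj x y = T (lookup (lookup B x) y) × T (lookup (lookup B y) x) × x ≢ y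

  toGraph : Graph
  toGraph = record
    { n = m
    ; Adj = BoolAdj
    ; sym = λ (xy , yx , x≢y) → yx , xy , x≢y ∘′ sym
    ; irrefl = λ (_ , _ , x≢x) → x≢x refl
    }

  boolAdj? : ∀ x y → Dec (BoolAdj x y)
  boolAdj? x y = T? _ ×-dec T? _ ×-dec ¬? (x ≟ᶠ y)

module _ (G : Graph) (adj? : ∀ x y → Dec (Adj G x y)) where

  boolGraph : BoolGraph (n G)
  boolGraph = tabulate λ x → tabulate λ y → isYes (adj? x y)

  entry : ∀ x y → lookup (lookup boolGraph x) y ≡ isYes (adj? x y)
  entry x y = trans (cong (λ row → lookup row y) (lookup∘tabulate _ x)) (lookup∘tabulate _ y)

  toBoolGraph : Hom G (toGraph boolGraph)
  toBoolGraph = mkHom (λ x → x) λ {x} {y} e →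
    subst T (sym (entry x y)) (fromWitness e) , subst T (sym (entry y x)) (fromWitness (Adj-sym G e)) ,
    λ { refl → irrefl G e }

  fromBoolGraph : Hom (toGraph boolGraph) G
  fromBoolGraph = mkHom (λ x → x) λ {x} {y} (xy , _ , _) → toWitness (subst T (entry x y) xy)

Good : ℕ → ℕ → Graph → Set
Good k l G = OddGirth G k × ¬ HomToOddCycle G l

good-transfer : ∀ {k l G H} (φ : Hom G H) (ψ : Hom H G) →
                Injective _≡_ _≡_ (Hom.map φ) → Injective _≡_ _≡_ (Hom.map ψ) → Good k l G → Good k l H
good-transfer {k} {l} φ ψ φ-injective ψ-injective ((cycle , noShorter) , ¬hom) =
  (hasOddCycle-transfer {r = k} φ φ-injective cycle ,
   λ r 1≤r r<k → noShorter r 1≤r r<k ∘′ hasOddCycle-transfer {r = r} ψ ψ-injective) ,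
  ¬hom ∘′ homToOddCycle-∘ {l = l} φ

Realisable : ℕ → ℕ → ℕ → Set
Realisable k l m = ∃[ B ] Good k l (toGraph {m} B)

realisable? : ∀ k l → Decidable (Realisable k l)
realisable? k l m = searchable-Vec {Vec Bool m} (searchable-Vec {Bool} searchable-Bool m) m λ B →
  oddGirth? (toGraph B) (boolAdj? B) k ×-dec ¬? (homToOddCycle? (toGraph B) (boolAdj? B) l)

¬¬-∀Fin : ∀ {N} {P : Fin N → Set} → (∀ i → ¬ ¬ P i) → ¬ ¬ (∀ i → P i)
¬¬-∀Fin {zero} _ ¬all = ¬all λ ()
¬¬-∀Fin {suc N} {P} ¬¬P ¬all = ¬¬P fzero λ p₀ → ¬¬-∀Fin {P = P ∘′ fsuc} (λ i → ¬¬P (fsuc i)) λ ps →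
  ¬all λ { fzero → p₀ ; (fsuc i) → ps i }

good⇒¬¬realisable : ∀ {k l G} → Good k l G → ¬ ¬ Realisable k l (n G)
good⇒¬¬realisable {k} {l} {G} good =
  ¬¬-map (λ adj? → boolGraph G adj? ,
                   good-transfer {k} {l} (toBoolGraph G adj?) (fromBoolGraph G adj?)
                                 (λ eq → eq) (λ eq → eq) good)
         (¬¬-∀Fin λ x → ¬¬-∀Fin λ y → ¬¬-excluded-middle)

leastWitness : ∀ {P : ℕ → Set} → Decidable P → ∀ {c} → P c → ∃[ b ] P b × (∀ {m} → m < b → ¬ P m)
leastWitness {P} P? {c} = <-rec (λ c → P c → ∃[ b ] P b × (∀ {m} → m < b → ¬ P m)) descend c
  where
  descend : ∀ c → (∀ {c'} → c' < c → P c' → ∃[ b ] P b × (∀ {m} → m < b → ¬ P m)) →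
            P c → ∃[ b ] P b × (∀ {m} → m < b → ¬ P m)
  descend c smaller pc with anyUpTo? P? c
  ... | yes (c' , c'<c , pc') = smaller c'<c pc'
  ... | no noneBelow = c , pc , λ m<c pm → noneBelow (_ , m<c , pm)

eta-exists : ∀ {k l N} → ¬ ¬ (∃[ G ] n G < N × Good k l G) → ∃[ b ] IsEta k l b
eta-exists {k} {l} {N} ¬¬small with decidable-stable (anyUpTo? (realisable? k l) N) ¬¬realisable
  where
  ¬¬realisable : ¬ ¬ (∃[ c ] c < N × Realisable k l c)
  ¬¬realisable none = ¬¬small λ (G , n<N , good) →
    good⇒¬¬realisable {k} {l} {G} good λ r → none (n G , n<N , r)
... | _ , _ , realisable with leastWitness (realisable? k l) realisable
...   | b , (B , good) , noneBelow = b , (toGraph B , refl , good) , λ H og ¬hom →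
  decidable-stable (b ≤? n H) λ b≰n → good⇒¬¬realisable {k} {l} {H} (og , ¬hom) (noneBelow (≰⇒> b≰n))

proposition7 : (k l : ℕ) → 1 ≤ l → l ≤ k →
    (a : ℕ) → IsEta (suc k) l a →
    Σ ℕ (λ b → IsEta k l b × b + 2 ≤ a)
proposition7 k l 1≤l l≤k .(n G) ((G , refl , og , ¬hom) , _) = b , eta , b+2≤n
  where
  smaller : ¬ ¬ (∃[ G' ] 2 + n G' ≡ n G × Good k l G')
  smaller = ¬¬-map (λ (G' , size , og' , φ) → G' , size , og' , ¬hom ∘′ homToOddCycle-∘ {l = l} φ)
                   (oddGirth⇒contraction G (≤-trans 1≤l l≤k) og)

  least : ∃[ b ] IsEta k l b
  least = eta-exists {k} {l} {n G}
    (¬¬-map (λ (G' , size , good) → G' , subst (n G' <_) size (m<n+m (n G') (s≤s z≤n)) , good) smaller)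

  b : ℕ
  b = proj₁ least

  eta : IsEta k l b
  eta = proj₂ least

  b+2≤n : b + 2 ≤ n G
  b+2≤n = decidable-stable (b + 2 ≤? n G) λ b+2≰n → smaller λ (G' , size , og' , ¬hom') →
    b+2≰n (subst (b + 2 ≤_) (trans (+-comm (n G') 2) size) (+-monoˡ-≤ 2 (proj₂ eta G' og' ¬hom')))
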